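{- Let $n$ be a positive integer and $q=(q_1,\ldots,q_{d-1},n)\in\mathbb{Z}^d$, set $q_d=1-\sum_{j=1}^{d-1}q_j$, and assume $q_i\mid n$ for all $i=1,\ldots,d$. Let $$L_1(x)=\sum_{j=0}^{n-1}x^{\sum_{i=1}^d\left\lceil\frac{q_ij+q_i^+}{n}\right\rceil-1}=\sum_{i=0}^{d-1}c_ix^i.$$ Then $L_1(x)$ is symmetric: $c_i=c_{d-1-i}$ for all $i=0,\ldots,d-1$.
   Context: For integer $a$, $a^+=\max(0,a)$. -}

module Defs where

open import Data.Nat as ℕ using (ℕ; NonZero)
open import Data.Integer using (ℤ; +_; -_; _+_; _-_; _*_; _⊔_; 0ℤ; 1ℤ)
open import Data.Integer.DivMod using (_/ℕ_)
open import Data.Fin using (Fin; zero; suc; toℕ; fromℕ<)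
open import Relation.Nullary using (yes; no)
open import Data.List using (List; upTo; filter; length)
open import Data.Integer.Properties using (_≟_)

_⁺ : ℤ → ℤ
a ⁺ = 0ℤ ⊔ a

-- ⌈ a / n ⌉ for a positive natural n (_/ℕ_ is floor division)
⌈_/_⌉ : ℤ → (n : ℕ) → .{{NonZero n}} → ℤ
⌈ a / n ⌉ = - ((- a) /ℕ n)

Σ[_] : {m : ℕ} → (Fin m → ℤ) → ℤ
Σ[_] {ℕ.zero} f = 0ℤ
Σ[_] {ℕ.suc m} f = f zero + Σ[_] (λ i → f (suc i))

-- the full weight vector (q₁,…,q_{d-1},q_d) with d = m+1 and
-- q_d = 1 - (q₁ + ⋯ + q_{d-1})
fullq : {m : ℕ} → (Fin m → ℤ) → Fin (ℕ.suc m) → ℤ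
fullq {m} q i with toℕ i ℕ.<? m
... | yes i<m = q (fromℕ< i<m)
... | no _ = 1ℤ - Σ[ q ]

expo : {m : ℕ} → (Fin m → ℤ) → (n : ℕ) → .{{NonZero n}} → ℕ → ℤ
expo q n j = Σ[ (λ i → ⌈ fullq q i * + j + (fullq q i) ⁺ / n ⌉) ] - 1ℤ

-- c_k : the coefficient of x^k in L₁(x) = Σ_{j=0}^{n-1} x^{expo j},
-- i.e. the number of j ∈ {0,…,n-1} with expo j = k
coeff : {m : ℕ} → (Fin m → ℤ) → (n : ℕ) → .{{NonZero n}} → ℤ → ℕ
coeff q n k = length (filter (λ j → expo q n j ≟ k) (upTo n))

{-# OPTIONS --safe #-}
module Submission where

-- Fix a coordinate c = qᵢ and put x = c j + c⁺; the numerator for n-1-j is then c n + |c| - x.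
-- Since |c| divides both n and x, ⌈(|c| - x)/n⌉ = 1 - ⌈x/n⌉, hence
-- ⌈(c (n-1-j) + c⁺)/n⌉ + ⌈(c j + c⁺)/n⌉ = c + 1. Summing over the d coordinates and using
-- Σ qᵢ = 1, the exponents e(j) of L₁ satisfy e(n-1-j) + e(j) = d - 1, so j ↦ n-1-j is a
-- bijection of {0,…,n-1} sending the exponent k to d-1-k.

open import Defs
open import Data.Nat using (ℕ; suc; NonZero; _<_; _∸_)
open import Data.Integer using (ℤ; +_)
open import Data.Integer.Divisibility using (_∣_)
open import Data.Fin using (Fin)
open import Relation.Binary.PropositionalEquality using (_≡_)

import Data.Nat as ℕ
import Data.Nat.Properties as ℕ
import Data.Nat.Divisibility as ℕ
open import Data.Integer as ℤ using (+[1+_]; -[1+_]; _+_; _-_; _*_; -_; 0ℤ; 1ℤ; ∣_∣)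
open import Data.Integer.Properties as ℤ using (_≟_)
open import Data.Integer.DivMod using (_/ℕ_; [n/ℕd]*d≤n; n<s[n/ℕd]*d)
open import Data.Integer.Divisibility.Signed
  using (divides; ∣-refl; ∣-trans; ∣m∣∣m; ∣ᵤ⇒∣; ∣⇒∣ᵤ; ∣m∣n⇒∣m+n; ∣m∣n⇒∣m-n; ∣n⇒∣m*n; ∣m⇒∣m*n)
  renaming (_∣_ to _∣ₛ_)
open import Data.Integer.Tactic.RingSolver using (solve-∀; solve)
open import Data.Fin using (zero; suc; toℕ; fromℕ; inject₁)
open import Data.Fin.Properties using (toℕ-injective; toℕ-fromℕ<; toℕ-inject₁; toℕ<n; toℕ-fromℕ)
open import Data.List using ([]; _∷_; length; filter; map; reverse; upTo; downFrom; applyUpTo)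
open import Data.List.Properties using (reverse-upTo; map-upTo)
open import Data.List.Relation.Unary.All as All using (All)
open import Data.List.Relation.Unary.All.Properties using (applyUpTo⁺₁)
open import Data.List.Relation.Binary.Permutation.Propositional using (↭-sym)
open import Data.List.Relation.Binary.Permutation.Propositional.Properties
  using (↭-length; ↭-reverse; filter-↭)
open import Function using (_∘_; id; _⇔_; mk⇔; Equivalence)
open import Relation.Nullary using (yes; no; contradiction)
open import Relation.Unary using (Pred; Decidable)
open import Relation.Binary.PropositionalEquality using (refl; sym; trans; cong; cong₂; subst; module ≡-Reasoning)

open import Algebra.Properties.AbelianGroup ℤ.+-0-abelianGroup using (∙-cancelˡ; ∙-cancelʳ)
open import Algebra.Properties.CommutativeSemigroup ℤ.+-commutativeSemigroup using (interchange)

m∣n⇒0<m : ∀ {m n} → m ℕ.∣ n → .{{NonZero n}} → 0 ℕ.< m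
m∣n⇒0<m {m} {n} m∣n = ℕ.n≢0⇒n>0 λ m≡0 →
  ℕ.≢-nonZero⁻¹ n (ℕ.0∣⇒≡0 (subst (ℕ._∣ n) m≡0 m∣n))

∣∧0<⇒≤ : ∀ {d k} → d ∣ₛ k → 0ℤ ℤ.< k → d ℤ.≤ k
∣∧0<⇒≤ {+ _}       {+[1+ _ ]} d∣k _ = ℤ.+≤+ (ℕ.∣⇒≤ (∣⇒∣ᵤ d∣k))
∣∧0<⇒≤ { -[1+ _ ]} {+[1+ _ ]} _   _ = ℤ.-≤+
∣∧0<⇒≤ {k = + 0} _ (ℤ.+<+ ())

∣∧<⇒+≤ : ∀ {d a b} → d ∣ₛ a → d ∣ₛ b → a ℤ.< b → a + d ℤ.≤ b
∣∧<⇒+≤ {d} {a} {b} d∣a d∣b a<b = begin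
  a + d        ≤⟨ ℤ.+-monoʳ-≤ a (∣∧0<⇒≤ (∣m∣n⇒∣m-n d∣b d∣a) 0<b-a) ⟩
  a + (b - a)  ≡⟨ solve (a ∷ b ∷ []) ⟩
  b            ∎
  where
  open ℤ.≤-Reasoning
  0<b-a : 0ℤ ℤ.< b - a
  0<b-a = begin-strict
    0ℤ     ≡⟨ ℤ.+-inverseʳ a ⟨
    a - a  <⟨ ℤ.+-monoˡ-< (- a) a<b ⟩
    b - a  ∎

i-1<j⇒i≤j : ∀ {i j} → i - 1ℤ ℤ.< j → i ℤ.≤ j
i-1<j⇒i≤j {i} {j} i-1<j = begin
  i              ≡⟨ solve (i ∷ []) ⟩
  1ℤ + (i - 1ℤ)  ≤⟨ ℤ.i<j⇒suc[i]≤j i-1<j ⟩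
  j              ∎
  where open ℤ.≤-Reasoning

a+b≡c+d⇒a≡c⇔b≡d : ∀ {a b c d} → a + b ≡ c + d → (a ≡ c) ⇔ (b ≡ d)
a+b≡c+d⇒a≡c⇔b≡d {a} {b} {c} {d} eq = mk⇔
  (λ { refl → ∙-cancelˡ a b d eq })
  (λ { refl → ∙-cancelʳ b a c eq })

i∣i⁺ : ∀ i → i ∣ₛ i ⁺
i∣i⁺ (+ _)    = ∣-refl
i∣i⁺ -[1+ _ ] = divides 0ℤ refl

∣i∣≡i⁺+i⁺-i : ∀ i → + ∣ i ∣ ≡ i ⁺ + i ⁺ - i
∣i∣≡i⁺+i⁺-i -[1+ _ ] = refl
∣i∣≡i⁺+i⁺-i (+ k)    = a≡a+a-a (+ k)
  where
  a≡a+a-a : ∀ a → a ≡ a + a - a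
  a≡a+a-a = solve-∀

record IsCeilDiv (x N t : ℤ) : Set where
  constructor isCeilDiv
  field
    lower : (t - 1ℤ) * N ℤ.< x
    upper : x ℤ.≤ t * N

isCeilDiv-unique : ∀ {x N s t} .{{_ : ℤ.NonNegative N}} →
  IsCeilDiv x N s → IsCeilDiv x N t → s ≡ t
isCeilDiv-unique {N = N} (isCeilDiv s-lo s-hi) (isCeilDiv t-lo t-hi) = ℤ.≤-antisym
  (i-1<j⇒i≤j (ℤ.*-cancelʳ-<-nonNeg N (ℤ.<-≤-trans s-lo t-hi)))
  (i-1<j⇒i≤j (ℤ.*-cancelʳ-<-nonNeg N (ℤ.<-≤-trans t-lo s-hi)))

isCeilDiv-shift : ∀ {x N t} k → IsCeilDiv x N t → IsCeilDiv (x + k * N) N (t + k)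
isCeilDiv-shift {x} {N} {t} k (isCeilDiv lo hi) = isCeilDiv lo′ hi′
  where
  open ℤ.≤-Reasoning
  lo′ : (t + k - 1ℤ) * N ℤ.< x + k * N
  lo′ = begin-strict
    (t + k - 1ℤ) * N      ≡⟨ solve (t ∷ k ∷ N ∷ []) ⟩
    (t - 1ℤ) * N + k * N  <⟨ ℤ.+-monoˡ-< (k * N) lo ⟩
    x + k * N             ∎
  hi′ : x + k * N ℤ.≤ (t + k) * N
  hi′ = begin
    x + k * N      ≤⟨ ℤ.+-monoˡ-≤ (k * N) hi ⟩
    t * N + k * N  ≡⟨ solve (t ∷ k ∷ N ∷ []) ⟩
    (t + k) * N    ∎

-- For the upper bound: x and (t - 1) N are multiples of g, so (t - 1) N < x forces (t - 1) N + g ≤ x.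
isCeilDiv-reflect : ∀ {g x N t} → 0ℤ ℤ.< g → g ∣ₛ N → g ∣ₛ x →
  IsCeilDiv x N t → IsCeilDiv (g - x) N (1ℤ - t)
isCeilDiv-reflect {g} {x} {N} {t} 0<g g∣N g∣x (isCeilDiv lo hi) = isCeilDiv lo′ hi′
  where
  open ℤ.≤-Reasoning
  lo′ : (1ℤ - t - 1ℤ) * N ℤ.< g - x
  lo′ = begin-strict
    (1ℤ - t - 1ℤ) * N  ≡⟨ solve (t ∷ N ∷ []) ⟩
    - (t * N)          ≤⟨ ℤ.neg-mono-≤ hi ⟩
    - x                ≡⟨ ℤ.+-identityˡ (- x) ⟨
    0ℤ - x             <⟨ ℤ.+-monoˡ-< (- x) 0<g ⟩
    g - x              ∎
  g∣[t-1]N : g ∣ₛ (t - 1ℤ) * N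
  g∣[t-1]N = ∣n⇒∣m*n (t - 1ℤ) g∣N
  hi′ : g - x ℤ.≤ (1ℤ - t) * N
  hi′ = begin
    g - x                   ≤⟨ ℤ.+-monoʳ-≤ g (ℤ.neg-mono-≤ (∣∧<⇒+≤ g∣[t-1]N g∣x lo)) ⟩
    g - ((t - 1ℤ) * N + g)  ≡⟨ solve (g ∷ t ∷ N ∷ []) ⟩
    (1ℤ - t) * N            ∎

module _ (n : ℕ) .{{_ : NonZero n}} where

  ⌈⌉-isCeilDiv : ∀ x → IsCeilDiv x (+ n) ⌈ x / n ⌉
  ⌈⌉-isCeilDiv x = isCeilDiv lo hi
    where
    open ℤ.≤-Reasoning
    ⌊-x/n⌋ : ℤ
    ⌊-x/n⌋ = - x /ℕ n
    [-u-1]*N≡-[[1+u]*N] : ∀ u N → (- u - 1ℤ) * N ≡ - ((1ℤ + u) * N)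
    [-u-1]*N≡-[[1+u]*N] = solve-∀
    lo : (⌈ x / n ⌉ - 1ℤ) * + n ℤ.< x
    lo = begin-strict
      (⌈ x / n ⌉ - 1ℤ) * + n       ≡⟨ [-u-1]*N≡-[[1+u]*N] ⌊-x/n⌋ (+ n) ⟩
      - ((1ℤ + ⌊-x/n⌋) * + n)      <⟨ ℤ.neg-mono-< (n<s[n/ℕd]*d (- x) n) ⟩
      - - x                        ≡⟨ ℤ.neg-involutive x ⟩
      x                            ∎
    hi : x ℤ.≤ ⌈ x / n ⌉ * + n
    hi = begin
      x                   ≡⟨ ℤ.neg-involutive x ⟨
      - - x               ≤⟨ ℤ.neg-mono-≤ ([n/ℕd]*d≤n (- x) n) ⟩
      - (⌊-x/n⌋ * + n)    ≡⟨ ℤ.neg-distribˡ-* ⌊-x/n⌋ (+ n) ⟩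
      ⌈ x / n ⌉ * + n     ∎

  isCeilDiv⇒⌈⌉≡ : ∀ {x t} → IsCeilDiv x (+ n) t → ⌈ x / n ⌉ ≡ t
  isCeilDiv⇒⌈⌉≡ {x} = isCeilDiv-unique (⌈⌉-isCeilDiv x)

  ⌈cj′+c⁺/n⌉+⌈cj+c⁺/n⌉≡c+1 : ∀ c j′ j → c ∣ + n → j′ + (1ℤ + j) ≡ + n →
    ⌈ c * j′ + c ⁺ / n ⌉ + ⌈ c * j + c ⁺ / n ⌉ ≡ c + 1ℤ
  ⌈cj′+c⁺/n⌉+⌈cj+c⁺/n⌉≡c+1 c j′ j c∣n j′+1+j≡n = begin
    ⌈ y / n ⌉ + t       ≡⟨ cong (_+ t) (isCeilDiv⇒⌈⌉≡ y-ceil) ⟩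
    (1ℤ - t + c) + t    ≡⟨ [1-t+c]+t≡c+1 t c ⟩
    c + 1ℤ              ∎
    where
    open ≡-Reasoning
    x y t : ℤ
    x = c * j + c ⁺
    y = c * j′ + c ⁺
    t = ⌈ x / n ⌉
    [1-t+c]+t≡c+1 : ∀ t c → (1ℤ - t + c) + t ≡ c + 1ℤ
    [1-t+c]+t≡c+1 = solve-∀
    [2p-c]-[cj+p]+c[j′+1+j]≡cj′+p : ∀ c j j′ p →
      ((p + p - c) - (c * j + p)) + c * (j′ + (1ℤ + j)) ≡ c * j′ + p
    [2p-c]-[cj+p]+c[j′+1+j]≡cj′+p = solve-∀
    ∣c∣-x+c*n≡y : + ∣ c ∣ - x + c * + n ≡ y
    ∣c∣-x+c*n≡y = begin
      + ∣ c ∣ - x + c * + n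
        ≡⟨ cong₂ (λ g N → g - x + c * N) (∣i∣≡i⁺+i⁺-i c) (sym j′+1+j≡n) ⟩
      (c ⁺ + c ⁺ - c) - (c * j + c ⁺) + c * (j′ + (1ℤ + j))
        ≡⟨ [2p-c]-[cj+p]+c[j′+1+j]≡cj′+p c j j′ (c ⁺) ⟩
      y  ∎
    ∣c∣∣ₛ : ∀ {k} → c ∣ₛ k → + ∣ c ∣ ∣ₛ k
    ∣c∣∣ₛ = ∣-trans ∣m∣∣m
    0<∣c∣ : 0ℤ ℤ.< + ∣ c ∣
    0<∣c∣ = ℤ.+<+ (m∣n⇒0<m c∣n)
    y-ceil : IsCeilDiv y (+ n) (1ℤ - t + c)
    y-ceil = subst (λ z → IsCeilDiv z (+ n) (1ℤ - t + c)) ∣c∣-x+c*n≡y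
      (isCeilDiv-shift c (isCeilDiv-reflect 0<∣c∣ (∣c∣∣ₛ (∣ᵤ⇒∣ c∣n))
        (∣c∣∣ₛ (∣m∣n⇒∣m+n (∣m⇒∣m*n j ∣-refl) (i∣i⁺ c))) (⌈⌉-isCeilDiv x)))

module _ {a b p q} {A : Set a} {B : Set b} {P : Pred B p} {Q : Pred A q}
         (P? : Decidable P) (Q? : Decidable Q) where

  length-filter-map : ∀ (f : A → B) {xs} → All (λ x → P (f x) ⇔ Q x) xs →
    length (filter P? (map f xs)) ≡ length (filter Q? xs)
  length-filter-map f All.[] = refl
  length-filter-map f {x ∷ _} (Pfx⇔Qx All.∷ rest) with P? (f x) | Q? x
  ... | yes _    | yes _   = cong suc (length-filter-map f rest)
  ... | no  _    | no  _   = length-filter-map f rest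
  ... | yes Pfx  | no  ¬Qx = contradiction (Equivalence.to Pfx⇔Qx Pfx) ¬Qx
  ... | no  ¬Pfx | yes Qx  = contradiction (Equivalence.from Pfx⇔Qx Qx) ¬Pfx

downFrom≡applyUpTo : ∀ n → downFrom n ≡ applyUpTo (λ j → n ∸ suc j) n
downFrom≡applyUpTo ℕ.zero  = refl
downFrom≡applyUpTo (suc n) = cong (n ∷_) (downFrom≡applyUpTo n)

length-filter-upTo-reflect : ∀ {p q} {P : Pred ℕ p} {Q : Pred ℕ q}
  (P? : Decidable P) (Q? : Decidable Q) n → (∀ {j} → j < n → P (n ∸ suc j) ⇔ Q j) →
  length (filter P? (upTo n)) ≡ length (filter Q? (upTo n))
length-filter-upTo-reflect P? Q? n P⇔Q = begin
  length (filter P? (upTo n))               ≡⟨ ↭-length (filter-↭ P? (↭-sym (↭-reverse (upTo n)))) ⟩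
  length (filter P? (reverse (upTo n)))     ≡⟨ cong (length ∘ filter P?) reverse-upTo≡map-reflect ⟩
  length (filter P? (map reflect (upTo n))) ≡⟨ length-filter-map P? Q? reflect (applyUpTo⁺₁ id n P⇔Q) ⟩
  length (filter Q? (upTo n))               ∎
  where
  open ≡-Reasoning
  reflect : ℕ → ℕ
  reflect j = n ∸ suc j
  reverse-upTo≡map-reflect : reverse (upTo n) ≡ map reflect (upTo n)
  reverse-upTo≡map-reflect =
    trans (reverse-upTo n) (trans (downFrom≡applyUpTo n) (sym (map-upTo reflect n)))

Σ-cong : ∀ {m} {f g : Fin m → ℤ} → (∀ i → f i ≡ g i) → Σ[ f ] ≡ Σ[ g ]
Σ-cong {ℕ.zero} _   = refl
Σ-cong {suc m}  f≗g = cong₂ _+_ (f≗g zero) (Σ-cong (f≗g ∘ suc))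

Σ-distrib-+ : ∀ {m} (f g : Fin m → ℤ) → Σ[ (λ i → f i + g i) ] ≡ Σ[ f ] + Σ[ g ]
Σ-distrib-+ {ℕ.zero} f g = refl
Σ-distrib-+ {suc m}  f g = trans
  (cong (_+_ (f zero + g zero)) (Σ-distrib-+ (f ∘ suc) (g ∘ suc)))
  (interchange (f zero) (g zero) Σ[ f ∘ suc ] Σ[ g ∘ suc ])

Σ-1≡m : ∀ m → Σ[ (λ (_ : Fin m) → 1ℤ) ] ≡ + m
Σ-1≡m ℕ.zero  = refl
Σ-1≡m (suc m) = cong (_+_ 1ℤ) (Σ-1≡m m)

Σ-last : ∀ {m} (f : Fin (suc m) → ℤ) → Σ[ f ] ≡ Σ[ f ∘ inject₁ ] + f (fromℕ m)
Σ-last {ℕ.zero} f = ℤ.+-comm (f zero) 0ℤ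
Σ-last {suc m}  f = trans (cong (_+_ (f zero)) (Σ-last (f ∘ suc))) (sym (ℤ.+-assoc (f zero) _ _))

fullq-inject₁ : ∀ {m} (q : Fin m → ℤ) i → fullq q (inject₁ i) ≡ q i
fullq-inject₁ {m} q i with toℕ (inject₁ i) ℕ.<? m
... | yes i<m = cong q (toℕ-injective (trans (toℕ-fromℕ< i<m) (toℕ-inject₁ i)))
... | no  i≮m = contradiction (subst (ℕ._< m) (sym (toℕ-inject₁ i)) (toℕ<n i)) i≮m

fullq-fromℕ : ∀ {m} (q : Fin m → ℤ) → fullq q (fromℕ m) ≡ 1ℤ - Σ[ q ]
fullq-fromℕ {m} q with toℕ (fromℕ m) ℕ.<? m
... | yes m<m = contradiction (subst (ℕ._< m) (toℕ-fromℕ m) m<m) (ℕ.<-irrefl refl)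
... | no  _   = refl

Σ-fullq : ∀ {m} (q : Fin m → ℤ) → Σ[ fullq q ] ≡ 1ℤ
Σ-fullq {m} q = begin
  Σ[ fullq q ]                                ≡⟨ Σ-last (fullq q) ⟩
  Σ[ fullq q ∘ inject₁ ] + fullq q (fromℕ m)  ≡⟨ cong₂ _+_ (Σ-cong (fullq-inject₁ q)) (fullq-fromℕ q) ⟩
  Σ[ q ] + (1ℤ - Σ[ q ])                      ≡⟨ s+[1-s]≡1 Σ[ q ] ⟩
  1ℤ                                          ∎
  where
  open ≡-Reasoning
  s+[1-s]≡1 : ∀ s → s + (1ℤ - s) ≡ 1ℤ
  s+[1-s]≡1 = solve-∀

module _ {m n : ℕ} .{{_ : NonZero n}} (q : Fin m → ℤ) (q∣n : ∀ i → fullq q i ∣ + n) where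

  private
    ⌈q*j+q⁺/n⌉ : ℕ → Fin (suc m) → ℤ
    ⌈q*j+q⁺/n⌉ j i = ⌈ fullq q i * + j + fullq q i ⁺ / n ⌉

  expo-reflect : ∀ {j′ j} → j′ ℕ.+ suc j ≡ n → expo q n j′ + expo q n j ≡ + m
  expo-reflect {j′} {j} j′+1+j≡n = begin
    expo q n j′ + expo q n j                  ≡⟨ [a-1]+[b-1]≡a+b-1-1 Σ[ ⌈q*j+q⁺/n⌉ j′ ] Σ[ ⌈q*j+q⁺/n⌉ j ] ⟩
    Σ[ ⌈q*j+q⁺/n⌉ j′ ] + Σ[ ⌈q*j+q⁺/n⌉ j ] - 1ℤ - 1ℤ
      ≡⟨ cong (λ s → s - 1ℤ - 1ℤ) (sym (Σ-distrib-+ (⌈q*j+q⁺/n⌉ j′) (⌈q*j+q⁺/n⌉ j))) ⟩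
    Σ[ (λ i → ⌈q*j+q⁺/n⌉ j′ i + ⌈q*j+q⁺/n⌉ j i) ] - 1ℤ - 1ℤ
      ≡⟨ cong (λ s → s - 1ℤ - 1ℤ) (Σ-cong λ i →
           ⌈cj′+c⁺/n⌉+⌈cj+c⁺/n⌉≡c+1 n (fullq q i) (+ j′) (+ j) (q∣n i) (cong +_ j′+1+j≡n)) ⟩
    Σ[ (λ i → fullq q i + 1ℤ) ] - 1ℤ - 1ℤ
      ≡⟨ cong (λ s → s - 1ℤ - 1ℤ) (trans (Σ-distrib-+ (fullq q) (λ _ → 1ℤ))
                                          (cong₂ _+_ (Σ-fullq q) (Σ-1≡m (suc m)))) ⟩
    1ℤ + (1ℤ + + m) - 1ℤ - 1ℤ                 ≡⟨ 1+[1+a]-1-1≡a (+ m) ⟩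
    + m                                       ∎
    where
    open ≡-Reasoning
    [a-1]+[b-1]≡a+b-1-1 : ∀ a b → (a - 1ℤ) + (b - 1ℤ) ≡ a + b - 1ℤ - 1ℤ
    [a-1]+[b-1]≡a+b-1-1 = solve-∀
    1+[1+a]-1-1≡a : ∀ a → 1ℤ + (1ℤ + a) - 1ℤ - 1ℤ ≡ a
    1+[1+a]-1-1≡a = solve-∀

proposition5p4 : (m : ℕ) (n : ℕ) .{{_ : NonZero n}} (q : Fin m → ℤ) →
    (∀ (i : Fin (suc m)) → fullq q i ∣ + n) →
    ∀ (i : ℕ) → i < suc m →
    coeff q n (+ i) ≡ coeff q n (+ (m ∸ i))
proposition5p4 m n q q∣n i i<1+m =
  length-filter-upTo-reflect (λ j → expo q n j ≟ + i) (λ j → expo q n j ≟ + (m ∸ i)) n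
    λ j<n → a+b≡c+d⇒a≡c⇔b≡d (trans (expo-reflect q q∣n (ℕ.m∸n+n≡m j<n)) (sym i+[m∸i]≡m))
  where
  i+[m∸i]≡m : + i + + (m ∸ i) ≡ + m
  i+[m∸i]≡m = cong +_ (ℕ.m+[n∸m]≡n (ℕ.≤-pred i<1+m))
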